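{- Let $d\geq1$ and $n\geq d+1$, and let $\alpha\in\mathcal{B}_{n,d}$. Let $r_{n,d}(\alpha)=\sum_{\ell=0}^{\lfloor (d-1)/2\rfloor}z_{2\ell+1}(\alpha)$. Then in the signed graph $\dot J(n,d)$, $$k_+(\alpha)=\begin{cases}\frac{d+1}{2}(n-d),& d\text{ odd},\\ \frac d2(n-d)+r_{n,d}(\alpha),& d\text{ even},\end{cases}\qquad k_-(\alpha)=\begin{cases}\frac{d-1}{2}(n-d),& d\text{ odd},\\ \frac d2(n-d)-r_{n,d}(\alpha),& d\text{ even}.\end{cases}$$ In particular, the graphs $J_+(n,d)$ and $J_-(n,d)$ are regular if and only if $d$ is odd.
   Context: $\mathcal{B}_{n,d}$ is the set of binary words of length $n$ with exactly $d$ ones. For $\alpha\in\mathcal{B}_{n,d}$: $z_0(\alpha)$ is the number of zeros before the first $1$, $z_d(\alpha)$ the number of zeros after the $d$-th $1$, and for $1\le i\le d-1$, $z_i(\alpha)$ is the number of zeros between the $i$-th and $(i+1)$-th occurrences of $1$. The Johnson graph $J(n,d)$ has vertex set $\mathcal{B}_{n,d}$, with $\alpha=a_1\cdots a_n,\beta=b_1\cdots b_n$ adjacent iff they differ in exactly two positions $i<j$; for such a pair let $h(\alpha,\beta)=|\{\ell:a_\ell=b_\ell=1,\ i<\ell<j\}|$. The signed graph $\dot J(n,d)$ is $J(n,d)$ with each edge $\{\alpha,\beta\}$ given sign $(-1)^{h(\alpha,\beta)}$. $k_+(\alpha)$ (resp. $k_-(\alpha)$) is the number of positive (resp. negative) edges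 incident to $\alpha$. $J_+(n,d)$ (resp. $J_-(n,d)$) is the graph on $\mathcal{B}_{n,d}$ whose edges are the positive (resp. negative) edges of $\dot J(n,d)$. -}

module Defs where

open import Data.Bool using (Bool; true; false; _∧_; if_then_else_)
open import Data.Nat using (ℕ; zero; suc; _+_; _*_; _<ᵇ_; _≡ᵇ_)
open import Data.Nat.Base using (⌊_/2⌋)
open import Data.Fin using (Fin; toℕ)
open import Data.Nat.ListAction using (sum)
open import Data.List using (List; []; _∷_; _++_; map; length; upTo; filterᵇ; allFin)
open import Data.Vec using (Vec; lookup)
import Data.Vec as V
open import Relation.Binary.PropositionalEquality using (_≡_)

Word : ℕ → Set
Word n = Vec Bool n

ones : ∀ {n} → Word n → ℕ
ones V.[] = 0
ones (true V.∷ w) = suc (ones w)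
ones (false V.∷ w) = ones w

InB : (n d : ℕ) → Word n → Set
InB n d α = ones α ≡ d

allWords : (n : ℕ) → List (Word n)
allWords zero = V.[] ∷ []
allWords (suc n) = map (false V.∷_) (allWords n) ++ map (true V.∷_) (allWords n)

Bnd : (n d : ℕ) → List (Word n)
Bnd n d = filterᵇ (λ w → ones w ≡ᵇ d) (allWords n)

-- zero-run lengths z_0, z_1, ..., z_d of a word with d ones
gaps : ∀ {n} → Word n → List ℕ
gaps V.[] = 0 ∷ []
gaps (true V.∷ w) = 0 ∷ gaps w
gaps (false V.∷ w) with gaps w
... | [] = 1 ∷ []
... | z ∷ zs = suc z ∷ zs

-- i-th entry of a list (0 when out of range)
nth : List ℕ → ℕ → ℕ
nth [] _ = 0
nth (x ∷ xs) zero = x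
nth (x ∷ xs) (suc i) = nth xs i

z : ∀ {n} → ℕ → Word n → ℕ
z i α = nth (gaps α) i

-- r_{n,d}(α) = Σ_{ℓ=0}^{⌊(d-1)/2⌋} z_{2ℓ+1}(α)   (for d ≥ 1, (d-1) = pred d)
r : ∀ {n} → (d : ℕ) → Word n → ℕ
r d α = sum (map (λ ℓ → z (2 * ℓ + 1) α) (upTo (suc ⌊ Data.Nat.pred d /2⌋)))

xorᵇ : Bool → Bool → Bool
xorᵇ true true = false
xorᵇ true false = true
xorᵇ false true = true
xorᵇ false false = false

diffPos : ∀ {n} → Word n → Word n → List (Fin n)
diffPos {n} α β = filterᵇ (λ k → xorᵇ (lookup α k) (lookup β k)) (allFin n)

-- adjacency in the Johnson graph J(n,d): differ in exactly two positions
adjᵇ : ∀ {n} → Word n → Word n → Bool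
adjᵇ α β = length (diffPos α β) ≡ᵇ 2

h : ∀ {n} → Word n → Word n → ℕ
h {n} α β with diffPos α β
... | i ∷ j ∷ [] = length (filterᵇ (λ l → (toℕ i <ᵇ toℕ l) ∧ (toℕ l <ᵇ toℕ j) ∧ lookup α l ∧ lookup β l) (allFin n))
... | _ = 0

evenᵇ : ℕ → Bool
evenᵇ zero = true
evenᵇ (suc k) = if evenᵇ k then false else true

-- k_+(α), k_-(α) in the signed graph J̇(n,d): edge sign is (-1)^h
kplus : (n d : ℕ) → Word n → ℕ
kplus n d α = length (filterᵇ (λ β → adjᵇ α β ∧ evenᵇ (h α β)) (Bnd n d))

kminus : (n d : ℕ) → Word n → ℕ
kminus n d α = length (filterᵇ (λ β → adjᵇ α β ∧ (if evenᵇ (h α β) then false else true)) (Bnd n d))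

RegularPlus : (n d : ℕ) → Set
RegularPlus n d = ∀ α β → InB n d α → InB n d β → kplus n d α ≡ kplus n d β

RegularMinus : (n d : ℕ) → Set
RegularMinus n d = ∀ α β → InB n d α → InB n d β → kminus n d α ≡ kminus n d β

-- An edge of J(n,d) at α moves one 1 of α onto a 0 of α, and its sign is the parity of the ones
-- that α and β share strictly between the two positions. Fix a 0 of α in the gap z_g, i.e. with
-- g ones before it: moving the k-th one onto it passes over g − k (for k ≤ g) or k − g − 1 (for
-- k > g) shared ones, so ⌈g/2⌉ + ⌈(d−g)/2⌉ of these d edges are positive, which is ⌈d/2⌉ for even g
-- and ⌊d/2⌋ + 1 for odd g. With E = z₀ + z₂ + ⋯ and O = z₁ + z₃ + ⋯ = r(α), so E + O = n − d,
--   k₊ = ⌈d/2⌉ E + (⌊d/2⌋ + 1) O   and   k₋ + O = ⌊d/2⌋ E + ⌈d/2⌉ O.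
-- For odd d both degrees are multiples of E + O; for even d they move with O, which is 0 for
-- 1^d 0^(n−d) but positive for 1 0 1^(d−1) 0^(n−d−1). The degrees are computed by recursion on the
-- first letter of α: a neighbour either keeps it, or flips it and then differs from α in exactly
-- one later position.

{-# OPTIONS --safe #-}
module Submission where

open import Defs
open import Data.Nat using (ℕ; _+_; _*_; _∸_; _≤_; _%_)
open import Data.Nat.Base using (⌊_/2⌋)
open import Data.Product using (_×_)
open import Function.Bundles using (_⇔_)
open import Relation.Binary.PropositionalEquality using (_≡_)

open import Algebra.Bundles using (CommutativeMonoid)
open import Data.Bool using (Bool; true; false; _∧_; not; if_then_else_; T?)
open import Data.Bool.Properties using (∧-commutativeMonoid)
open import Data.Fin using (Fin; toℕ) renaming (zero to fzero; suc to fsuc)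
open import Data.List using (List; []; _∷_; _++_; map; length; filterᵇ; allFin; upTo; applyUpTo)
open import Data.List.Properties
  using (filter-++; length-++; length-map; map-tabulate; map-upTo; ∷-injectiveˡ; ∷-injectiveʳ)
open import Data.Nat using (zero; suc; _<_; s≤s; z≤n; _≡ᵇ_; _<ᵇ_)
open import Data.Nat.Base using (⌈_/2⌉)
open import Data.Nat.ListAction using (sum)
open import Data.Nat.Properties
  using (+-identityʳ; +-comm; +-suc; *-suc; *-distribˡ-+; +-cancelˡ-≡; +-cancelʳ-≡; m+n∸m≡n; m≤n⇒m≤1+n; 0≢1+n)
open import Data.Nat.Tactic.RingSolver using (solve-∀)
open import Data.Product using (_,_; ∃-syntax)
open import Data.Sum using (_⊎_; inj₁; inj₂)
open import Data.Vec using (lookup) renaming ([] to []ᵛ; _∷_ to _∷ᵛ_)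
open import Function using (_∘_; id)
open import Function.Bundles using (mk⇔)
open import Relation.Binary.PropositionalEquality
  using (_≢_; _≗_; refl; sym; trans; cong; cong₂; subst; module ≡-Reasoning)
open import Relation.Nullary using (contradiction)
open import Algebra.Properties.CommutativeSemigroup (CommutativeMonoid.commutativeSemigroup ∧-commutativeMonoid)
  using (x∙yz≈y∙xz)

indicator : Bool → ℕ
indicator true = 1
indicator false = 0

module _ {A : Set} where

  count : (A → Bool) → List A → ℕ
  count p xs = length (filterᵇ p xs)

  count-∷ : ∀ p x xs → count p (x ∷ xs) ≡ indicator (p x) + count p xs
  count-∷ p x xs with p x
  ... | true = refl
  ... | false = refl

  count-++ : ∀ p xs ys → count p (xs ++ ys) ≡ count p xs + count p ys
  count-++ p xs ys = trans (cong length (filter-++ (T? ∘ p) xs ys)) (length-++ (filterᵇ p xs))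

  count-cong : ∀ {p q} → p ≗ q → ∀ xs → count p xs ≡ count q xs
  count-cong p≗q [] = refl
  count-cong {p} {q} p≗q (x ∷ xs) = begin
    count p (x ∷ xs)                ≡⟨ count-∷ p x xs ⟩
    indicator (p x) + count p xs    ≡⟨ cong₂ _+_ (cong indicator (p≗q x)) (count-cong p≗q xs) ⟩
    indicator (q x) + count q xs    ≡⟨ sym (count-∷ q x xs) ⟩
    count q (x ∷ xs)                ∎
    where open ≡-Reasoning

  count-none : ∀ {p} → (∀ x → p x ≡ false) → ∀ xs → count p xs ≡ 0
  count-none p≡false xs = trans (count-cong p≡false xs) (cong length (filter-none xs))
    where
    filter-none : ∀ xs → filterᵇ (λ _ → false) xs ≡ []
    filter-none [] = refl
    filter-none (_ ∷ xs) = filter-none xs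

  count-filterᵇ : ∀ p q xs → count p (filterᵇ q xs) ≡ count (λ x → q x ∧ p x) xs
  count-filterᵇ p q [] = refl
  count-filterᵇ p q (x ∷ xs) with q x
  ... | false = count-filterᵇ p q xs
  ... | true with p x
  ...   | true = cong suc (count-filterᵇ p q xs)
  ...   | false = count-filterᵇ p q xs

  filterᵇ-∷ : ∀ (p : A → Bool) x xs → filterᵇ p (x ∷ xs) ≡ (if p x then x ∷ filterᵇ p xs else filterᵇ p xs)
  filterᵇ-∷ p x xs with p x
  ... | true = refl
  ... | false = refl

module _ {A B : Set} where

  filterᵇ-map : ∀ (p : B → Bool) (f : A → B) xs → filterᵇ p (map f xs) ≡ map f (filterᵇ (p ∘ f) xs)
  filterᵇ-map p f [] = refl
  filterᵇ-map p f (x ∷ xs) with p (f x)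
  ... | true = cong (f x ∷_) (filterᵇ-map p f xs)
  ... | false = filterᵇ-map p f xs

  count-map : ∀ (p : B → Bool) (f : A → B) xs → count p (map f xs) ≡ count (p ∘ f) xs
  count-map p f xs = trans (cong length (filterᵇ-map p f xs)) (length-map f (filterᵇ (p ∘ f) xs))

countWords : (n : ℕ) → (Word n → Bool) → ℕ
countWords n p = count p (allWords n)

countWords-suc : ∀ n p → countWords (suc n) p ≡ countWords n (p ∘ (false ∷ᵛ_)) + countWords n (p ∘ (true ∷ᵛ_))
countWords-suc n p = begin
  count p (map (false ∷ᵛ_) (allWords n) ++ map (true ∷ᵛ_) (allWords n))
    ≡⟨ count-++ p (map (false ∷ᵛ_) (allWords n)) _ ⟩
  count p (map (false ∷ᵛ_) (allWords n)) + count p (map (true ∷ᵛ_) (allWords n))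
    ≡⟨ cong₂ _+_ (count-map p (false ∷ᵛ_) (allWords n)) (count-map p (true ∷ᵛ_) (allWords n)) ⟩
  countWords n (p ∘ (false ∷ᵛ_)) + countWords n (p ∘ (true ∷ᵛ_)) ∎
  where open ≡-Reasoning

allFin-suc : ∀ n → allFin (suc n) ≡ fzero ∷ map fsuc (allFin n)
allFin-suc n = cong (fzero ∷_) (sym (map-tabulate id fsuc))

count-allFin-suc : ∀ {n} p → count p (allFin (suc n)) ≡ indicator (p fzero) + count (p ∘ fsuc) (allFin n)
count-allFin-suc {n} p = begin
  count p (allFin (suc n))
    ≡⟨ cong (count p) (allFin-suc n) ⟩
  count p (fzero ∷ map fsuc (allFin n))
    ≡⟨ count-∷ p fzero _ ⟩
  indicator (p fzero) + count p (map fsuc (allFin n))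
    ≡⟨ cong (indicator (p fzero) +_) (count-map p fsuc (allFin n)) ⟩
  indicator (p fzero) + count (p ∘ fsuc) (allFin n) ∎
  where open ≡-Reasoning

hamming : ∀ {n} → Word n → Word n → ℕ
hamming []ᵛ []ᵛ = 0
hamming (a ∷ᵛ α) (b ∷ᵛ β) = indicator (xorᵇ a b) + hamming α β

sharedOnesBeforeDiff : ∀ {n} → Word n → Word n → ℕ
sharedOnesBeforeDiff []ᵛ []ᵛ = 0
sharedOnesBeforeDiff (a ∷ᵛ α) (b ∷ᵛ β) = if xorᵇ a b then 0 else indicator (a ∧ b) + sharedOnesBeforeDiff α β

sharedOnesBetweenDiffs : ∀ {n} → Word n → Word n → ℕ
sharedOnesBetweenDiffs []ᵛ []ᵛ = 0
sharedOnesBetweenDiffs (a ∷ᵛ α) (b ∷ᵛ β) = if xorᵇ a b then sharedOnesBeforeDiff α β else sharedOnesBetweenDiffs α β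

diffPos-∷ : ∀ {n} a b (α β : Word n) →
  diffPos (a ∷ᵛ α) (b ∷ᵛ β) ≡ (if xorᵇ a b then fzero ∷ map fsuc (diffPos α β) else map fsuc (diffPos α β))
diffPos-∷ {n} a b α β = begin
  filterᵇ differ (allFin (suc n))
    ≡⟨ cong (filterᵇ differ) (allFin-suc n) ⟩
  filterᵇ differ (fzero ∷ map fsuc (allFin n))
    ≡⟨ filterᵇ-∷ differ fzero (map fsuc (allFin n)) ⟩
  (if xorᵇ a b then fzero ∷ filterᵇ differ (map fsuc (allFin n)) else filterᵇ differ (map fsuc (allFin n)))
    ≡⟨ cong (λ xs → if xorᵇ a b then fzero ∷ xs else xs) (filterᵇ-map differ fsuc (allFin n)) ⟩
  (if xorᵇ a b then fzero ∷ map fsuc (diffPos α β) else map fsuc (diffPos α β)) ∎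
  where
  open ≡-Reasoning
  differ : Fin (suc n) → Bool
  differ k = xorᵇ (lookup (a ∷ᵛ α) k) (lookup (b ∷ᵛ β) k)

length-diffPos : ∀ {n} (α β : Word n) → length (diffPos α β) ≡ hamming α β
length-diffPos []ᵛ []ᵛ = refl
length-diffPos (a ∷ᵛ α) (b ∷ᵛ β) with xorᵇ a b | diffPos-∷ a b α β
... | true | eq =
  trans (cong length eq) (cong suc (trans (length-map fsuc (diffPos α β)) (length-diffPos α β)))
... | false | eq = trans (cong length eq) (trans (length-map fsuc (diffPos α β)) (length-diffPos α β))

module _ {A B : Set} {f : A → B} where

  map-≡-[_]⁻ : ∀ xs {y} → map f xs ≡ y ∷ [] → ∃[ x ] xs ≡ x ∷ [] × f x ≡ y
  map-≡-[_]⁻ (x ∷ []) refl = x , refl , refl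

  map-≡-[_,_]⁻ : ∀ xs {y z} → map f xs ≡ y ∷ z ∷ [] → ∃[ x ] ∃[ x′ ] xs ≡ x ∷ x′ ∷ [] × f x ≡ y × f x′ ≡ z
  map-≡-[_,_]⁻ (x ∷ x′ ∷ []) refl = x , x′ , refl , refl , refl

sharedOneBelowᵇ : ∀ {n} → Word n → Word n → Fin n → Fin n → Bool
sharedOneBelowᵇ α β j l = (toℕ l <ᵇ toℕ j) ∧ lookup α l ∧ lookup β l

sharedOnesBelow : ∀ {n} → Word n → Word n → Fin n → ℕ
sharedOnesBelow {n} α β j = count (sharedOneBelowᵇ α β j) (allFin n)

sharedOnesBetween : ∀ {n} → Word n → Word n → Fin n → Fin n → ℕ
sharedOnesBetween {n} α β i j = count (λ l → (toℕ i <ᵇ toℕ l) ∧ sharedOneBelowᵇ α β j l) (allFin n)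

h-unfold : ∀ {n} {α β : Word n} {i j} → diffPos α β ≡ i ∷ j ∷ [] → h α β ≡ sharedOnesBetween α β i j
h-unfold {α = α} {β} eq with diffPos α β
h-unfold refl | _ = refl

sharedOnesBelow-diffPos : ∀ {n} (α β : Word n) {j} → diffPos α β ≡ j ∷ [] →
  sharedOnesBelow α β j ≡ sharedOnesBeforeDiff α β
sharedOnesBelow-diffPos {suc n} (a ∷ᵛ α) (b ∷ᵛ β) eq with xorᵇ a b | diffPos-∷ a b α β
... | true | eq′ with refl ← ∷-injectiveˡ (trans (sym eq′) eq) =
  count-none {p = sharedOneBelowᵇ (a ∷ᵛ α) (b ∷ᵛ β) fzero} (λ _ → refl) (allFin (suc n))
... | false | eq′ with j , D≡[j] , refl ← map-≡-[ diffPos α β ]⁻ (trans (sym eq′) eq) =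
  trans (count-allFin-suc (sharedOneBelowᵇ (a ∷ᵛ α) (b ∷ᵛ β) (fsuc j)))
        (cong (indicator (a ∧ b) +_) (sharedOnesBelow-diffPos α β D≡[j]))

sharedOnesBetween-diffPos : ∀ {n} (α β : Word n) {i j} → diffPos α β ≡ i ∷ j ∷ [] →
  sharedOnesBetween α β i j ≡ sharedOnesBetweenDiffs α β
sharedOnesBetween-diffPos (a ∷ᵛ α) (b ∷ᵛ β) eq with xorᵇ a b | diffPos-∷ a b α β
... | true | eq′
  with refl ← ∷-injectiveˡ (trans (sym eq′) eq)
     | j , D≡[j] , refl ← map-≡-[ diffPos α β ]⁻ (∷-injectiveʳ (trans (sym eq′) eq)) =
  trans (count-allFin-suc (λ l → (0 <ᵇ toℕ l) ∧ sharedOneBelowᵇ (a ∷ᵛ α) (b ∷ᵛ β) (fsuc j) l))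
        (sharedOnesBelow-diffPos α β D≡[j])
sharedOnesBetween-diffPos (a ∷ᵛ α) (b ∷ᵛ β) eq | false | eq′
  with i , j , D≡[i,j] , refl , refl ← map-≡-[_,_]⁻ (diffPos α β) (trans (sym eq′) eq) =
  trans (count-allFin-suc (λ l → (suc (toℕ i) <ᵇ toℕ l) ∧ sharedOneBelowᵇ (a ∷ᵛ α) (b ∷ᵛ β) (fsuc j) l))
        (sharedOnesBetween-diffPos α β D≡[i,j])

h≡sharedOnesBetweenDiffs : ∀ {n} (α β : Word n) {i j} → diffPos α β ≡ i ∷ j ∷ [] →
  h α β ≡ sharedOnesBetweenDiffs α β
h≡sharedOnesBetweenDiffs α β eq = trans (h-unfold eq) (sharedOnesBetween-diffPos α β eq)

-- Signed neighbours, counted letter by letter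

-- A Bool t encodes a parity, true meaning even.
hasParityᵇ : Bool → ℕ → Bool
hasParityᵇ true k = evenᵇ k
hasParityᵇ false k = if evenᵇ k then false else true

hasParityᵇ-zero : ∀ t → hasParityᵇ t 0 ≡ t
hasParityᵇ-zero true = refl
hasParityᵇ-zero false = refl

hasParityᵇ-suc : ∀ t k → hasParityᵇ t (suc k) ≡ hasParityᵇ (not t) k
hasParityᵇ-suc true k = refl
hasParityᵇ-suc false k with evenᵇ k
... | true = refl
... | false = refl

signedDegree : Bool → (n d : ℕ) → Word n → ℕ
signedDegree t n d α = count (λ β → adjᵇ α β ∧ hasParityᵇ t (h α β)) (Bnd n d)

module _ {n : ℕ} (t : Bool) (α : Word n) where

  movesOneᵇ addsOneᵇ dropsOneᵇ : Word n → Bool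
  movesOneᵇ β = (hamming α β ≡ᵇ 2) ∧ (ones β ≡ᵇ ones α) ∧ hasParityᵇ t (sharedOnesBetweenDiffs α β)
  addsOneᵇ β = (hamming α β ≡ᵇ 1) ∧ (ones β ≡ᵇ suc (ones α)) ∧ hasParityᵇ t (sharedOnesBeforeDiff α β)
  dropsOneᵇ β = (hamming α β ≡ᵇ 1) ∧ (suc (ones β) ≡ᵇ ones α) ∧ hasParityᵇ t (sharedOnesBeforeDiff α β)

adjᵇ∧sign : ∀ {n} t (α β : Word n) →
  adjᵇ α β ∧ hasParityᵇ t (h α β) ≡ (hamming α β ≡ᵇ 2) ∧ hasParityᵇ t (sharedOnesBetweenDiffs α β)
adjᵇ∧sign t α β = trans (onPairs (diffPos α β) refl)
  (cong (λ k → (k ≡ᵇ 2) ∧ hasParityᵇ t (sharedOnesBetweenDiffs α β)) (length-diffPos α β))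
  where
  onPairs : ∀ D → diffPos α β ≡ D →
    (length D ≡ᵇ 2) ∧ hasParityᵇ t (h α β) ≡ (length D ≡ᵇ 2) ∧ hasParityᵇ t (sharedOnesBetweenDiffs α β)
  onPairs [] _ = refl
  onPairs (_ ∷ []) _ = refl
  onPairs (_ ∷ _ ∷ []) eq = cong (hasParityᵇ t) (h≡sharedOnesBetweenDiffs α β eq)
  onPairs (_ ∷ _ ∷ _ ∷ _) _ = refl

signedDegree≡movesOne : ∀ {n} t (α : Word n) → signedDegree t n (ones α) α ≡ countWords n (movesOneᵇ t α)
signedDegree≡movesOne {n} t α =
  trans (count-filterᵇ _ (λ β → ones β ≡ᵇ ones α) (allWords n)) (count-cong reorder (allWords n))
  where
  reorder : ∀ β → (ones β ≡ᵇ ones α) ∧ adjᵇ α β ∧ hasParityᵇ t (h α β) ≡ movesOneᵇ t α β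
  reorder β = trans (cong ((ones β ≡ᵇ ones α) ∧_) (adjᵇ∧sign t α β))
    (x∙yz≈y∙xz (ones β ≡ᵇ ones α) (hamming α β ≡ᵇ 2) _)

m≡ᵇm : ∀ m → (m ≡ᵇ m) ≡ true
m≡ᵇm zero = refl
m≡ᵇm (suc m) = m≡ᵇm m

m≢ᵇ2+m : ∀ m → (m ≡ᵇ 2 + m) ≡ false
m≢ᵇ2+m zero = refl
m≢ᵇ2+m (suc m) = m≢ᵇ2+m m

2+m≢ᵇm : ∀ m → (2 + m ≡ᵇ m) ≡ false
2+m≢ᵇm zero = refl
2+m≢ᵇm (suc m) = 2+m≢ᵇm m

countWords-hamming≡0 : ∀ {n} (α : Word n) (q : Word n → Bool) →
  countWords n (λ β → (hamming α β ≡ᵇ 0) ∧ q β) ≡ indicator (q α)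
countWords-hamming≡0 []ᵛ q =
  trans (count-∷ (λ β → (hamming []ᵛ β ≡ᵇ 0) ∧ q β) []ᵛ []) (+-identityʳ (indicator (q []ᵛ)))
countWords-hamming≡0 {suc n} (false ∷ᵛ α) q = begin
  countWords (suc n) (λ β → (hamming (false ∷ᵛ α) β ≡ᵇ 0) ∧ q β)
    ≡⟨ countWords-suc n _ ⟩
  countWords n (λ β → (hamming α β ≡ᵇ 0) ∧ q (false ∷ᵛ β)) + countWords n (λ _ → false)
    ≡⟨ cong₂ _+_ (countWords-hamming≡0 α (q ∘ (false ∷ᵛ_))) (count-none (λ _ → refl) (allWords n)) ⟩
  indicator (q (false ∷ᵛ α)) + 0
    ≡⟨ +-identityʳ _ ⟩
  indicator (q (false ∷ᵛ α)) ∎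
  where open ≡-Reasoning
countWords-hamming≡0 {suc n} (true ∷ᵛ α) q = begin
  countWords (suc n) (λ β → (hamming (true ∷ᵛ α) β ≡ᵇ 0) ∧ q β)
    ≡⟨ countWords-suc n _ ⟩
  countWords n (λ _ → false) + countWords n (λ β → (hamming α β ≡ᵇ 0) ∧ q (true ∷ᵛ β))
    ≡⟨ cong₂ _+_ (count-none (λ _ → refl) (allWords n)) (countWords-hamming≡0 α (q ∘ (true ∷ᵛ_))) ⟩
  indicator (q (true ∷ᵛ α)) ∎
  where open ≡-Reasoning

-- zerosInGaps true α = z₀(α) + z₂(α) + ⋯ and zerosInGaps false α = z₁(α) + z₃(α) + ⋯.
zerosInGaps : ∀ {n} → Bool → Word n → ℕ
zerosInGaps t []ᵛ = 0
zerosInGaps t (false ∷ᵛ α) = indicator t + zerosInGaps t α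
zerosInGaps t (true ∷ᵛ α) = zerosInGaps (not t) α

half : Bool → ℕ → ℕ
half true d = ⌈ d /2⌉
half false d = ⌊ d /2⌋

half-suc : ∀ t d → half t (suc d) ≡ indicator t + half (not t) d
half-suc true d = refl
half-suc false d = refl

addsOneᵇ-after-one : ∀ {n} t (α : Word n) β → addsOneᵇ t (true ∷ᵛ α) (true ∷ᵛ β) ≡ addsOneᵇ (not t) α β
addsOneᵇ-after-one t α β =
  cong (λ b → (hamming α β ≡ᵇ 1) ∧ (ones β ≡ᵇ suc (ones α)) ∧ b) (hasParityᵇ-suc t (sharedOnesBeforeDiff α β))

dropsOneᵇ-after-one : ∀ {n} t (α : Word n) β → dropsOneᵇ t (true ∷ᵛ α) (true ∷ᵛ β) ≡ dropsOneᵇ (not t) α β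
dropsOneᵇ-after-one t α β =
  cong (λ b → (hamming α β ≡ᵇ 1) ∧ (suc (ones β) ≡ᵇ ones α) ∧ b) (hasParityᵇ-suc t (sharedOnesBeforeDiff α β))

countWords-addsOne : ∀ {n} t (α : Word n) → countWords n (addsOneᵇ t α) ≡ zerosInGaps t α
countWords-addsOne t []ᵛ = refl
countWords-addsOne {suc n} t (false ∷ᵛ α) = begin
  countWords (suc n) (addsOneᵇ t (false ∷ᵛ α))
    ≡⟨ countWords-suc n _ ⟩
  countWords n (addsOneᵇ t α) + countWords n (λ β → (hamming α β ≡ᵇ 0) ∧ (ones β ≡ᵇ ones α) ∧ hasParityᵇ t 0)
    ≡⟨ cong₂ _+_ (countWords-addsOne t α) (countWords-hamming≡0 α _) ⟩
  zerosInGaps t α + indicator ((ones α ≡ᵇ ones α) ∧ hasParityᵇ t 0)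
    ≡⟨ cong (λ b → zerosInGaps t α + indicator (b ∧ hasParityᵇ t 0)) (m≡ᵇm (ones α)) ⟩
  zerosInGaps t α + indicator (hasParityᵇ t 0)
    ≡⟨ cong (λ b → zerosInGaps t α + indicator b) (hasParityᵇ-zero t) ⟩
  zerosInGaps t α + indicator t
    ≡⟨ +-comm (zerosInGaps t α) (indicator t) ⟩
  zerosInGaps t (false ∷ᵛ α) ∎
  where open ≡-Reasoning
countWords-addsOne {suc n} t (true ∷ᵛ α) = begin
  countWords (suc n) (addsOneᵇ t (true ∷ᵛ α))
    ≡⟨ countWords-suc n _ ⟩
  countWords n (λ β → (hamming α β ≡ᵇ 0) ∧ (ones β ≡ᵇ 2 + ones α) ∧ hasParityᵇ t 0)
    + countWords n (addsOneᵇ t (true ∷ᵛ α) ∘ (true ∷ᵛ_))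
    ≡⟨ cong₂ _+_ (countWords-hamming≡0 α _) (count-cong (addsOneᵇ-after-one t α) (allWords n)) ⟩
  indicator ((ones α ≡ᵇ 2 + ones α) ∧ hasParityᵇ t 0) + countWords n (addsOneᵇ (not t) α)
    ≡⟨ cong₂ _+_ (cong (λ b → indicator (b ∧ hasParityᵇ t 0)) (m≢ᵇ2+m (ones α))) (countWords-addsOne (not t) α) ⟩
  zerosInGaps (not t) α ∎
  where open ≡-Reasoning

countWords-dropsOne : ∀ {n} t (α : Word n) → countWords n (dropsOneᵇ t α) ≡ half t (ones α)
countWords-dropsOne true []ᵛ = refl
countWords-dropsOne false []ᵛ = refl
countWords-dropsOne {suc n} t (false ∷ᵛ α) = begin
  countWords (suc n) (dropsOneᵇ t (false ∷ᵛ α))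
    ≡⟨ countWords-suc n _ ⟩
  countWords n (dropsOneᵇ t α) + countWords n (λ β → (hamming α β ≡ᵇ 0) ∧ (2 + ones β ≡ᵇ ones α) ∧ hasParityᵇ t 0)
    ≡⟨ cong₂ _+_ (countWords-dropsOne t α) (countWords-hamming≡0 α _) ⟩
  half t (ones α) + indicator ((2 + ones α ≡ᵇ ones α) ∧ hasParityᵇ t 0)
    ≡⟨ cong (λ b → half t (ones α) + indicator (b ∧ hasParityᵇ t 0)) (2+m≢ᵇm (ones α)) ⟩
  half t (ones α) + 0
    ≡⟨ +-identityʳ _ ⟩
  half t (ones α) ∎
  where open ≡-Reasoning
countWords-dropsOne {suc n} t (true ∷ᵛ α) = begin
  countWords (suc n) (dropsOneᵇ t (true ∷ᵛ α))
    ≡⟨ countWords-suc n _ ⟩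
  countWords n (λ β → (hamming α β ≡ᵇ 0) ∧ (ones β ≡ᵇ ones α) ∧ hasParityᵇ t 0)
    + countWords n (dropsOneᵇ t (true ∷ᵛ α) ∘ (true ∷ᵛ_))
    ≡⟨ cong₂ _+_ (countWords-hamming≡0 α _) (count-cong (dropsOneᵇ-after-one t α) (allWords n)) ⟩
  indicator ((ones α ≡ᵇ ones α) ∧ hasParityᵇ t 0) + countWords n (dropsOneᵇ (not t) α)
    ≡⟨ cong₂ _+_ (cong (λ b → indicator (b ∧ hasParityᵇ t 0)) (m≡ᵇm (ones α))) (countWords-dropsOne (not t) α) ⟩
  indicator (hasParityᵇ t 0) + half (not t) (ones α)
    ≡⟨ cong (λ b → indicator b + half (not t) (ones α)) (hasParityᵇ-zero t) ⟩
  indicator t + half (not t) (ones α)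
    ≡⟨ sym (half-suc t (ones α)) ⟩
  half t (suc (ones α)) ∎
  where open ≡-Reasoning

countWords-movesOne-even : ∀ {n} (α : Word n) →
  countWords n (movesOneᵇ true α) ≡ ⌈ ones α /2⌉ * zerosInGaps true α + suc ⌊ ones α /2⌋ * zerosInGaps false α
countWords-movesOne-even []ᵛ = refl
countWords-movesOne-even {suc n} (false ∷ᵛ α) = begin
  countWords (suc n) (movesOneᵇ true (false ∷ᵛ α))
    ≡⟨ countWords-suc n _ ⟩
  countWords n (movesOneᵇ true α) + countWords n (dropsOneᵇ true α)
    ≡⟨ cong₂ _+_ (countWords-movesOne-even α) (countWords-dropsOne true α) ⟩
  ⌈ ones α /2⌉ * zerosInGaps true α + suc ⌊ ones α /2⌋ * zerosInGaps false α + ⌈ ones α /2⌉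
    ≡⟨ zero-in-even-gap ⌈ ones α /2⌉ ⌊ ones α /2⌋ (zerosInGaps true α) (zerosInGaps false α) ⟩
  ⌈ ones α /2⌉ * suc (zerosInGaps true α) + suc ⌊ ones α /2⌋ * zerosInGaps false α ∎
  where
  open ≡-Reasoning
  zero-in-even-gap : ∀ c f e o → c * e + suc f * o + c ≡ c * suc e + suc f * o
  zero-in-even-gap = solve-∀
countWords-movesOne-even {suc n} (true ∷ᵛ α) = begin
  countWords (suc n) (movesOneᵇ true (true ∷ᵛ α))
    ≡⟨ countWords-suc n _ ⟩
  countWords n (addsOneᵇ true α) + countWords n (movesOneᵇ true α)
    ≡⟨ cong₂ _+_ (countWords-addsOne true α) (countWords-movesOne-even α) ⟩
  zerosInGaps true α + (⌈ ones α /2⌉ * zerosInGaps true α + suc ⌊ ones α /2⌋ * zerosInGaps false α)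
    ≡⟨ one-swaps-gaps ⌈ ones α /2⌉ ⌊ ones α /2⌋ (zerosInGaps true α) (zerosInGaps false α) ⟩
  suc ⌊ ones α /2⌋ * zerosInGaps false α + suc ⌈ ones α /2⌉ * zerosInGaps true α ∎
  where
  open ≡-Reasoning
  one-swaps-gaps : ∀ c f e o → e + (c * e + suc f * o) ≡ suc f * o + suc c * e
  one-swaps-gaps = solve-∀

countWords-movesOne-odd : ∀ {n} (α : Word n) →
  countWords n (movesOneᵇ false α) + zerosInGaps false α
    ≡ ⌊ ones α /2⌋ * zerosInGaps true α + ⌈ ones α /2⌉ * zerosInGaps false α
countWords-movesOne-odd []ᵛ = refl
countWords-movesOne-odd {suc n} (false ∷ᵛ α) = begin
  countWords (suc n) (movesOneᵇ false (false ∷ᵛ α)) + zerosInGaps false (false ∷ᵛ α)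
    ≡⟨ cong (_+ zerosInGaps false (false ∷ᵛ α)) (countWords-suc n _) ⟩
  countWords n (movesOneᵇ false α) + countWords n (dropsOneᵇ false α) + zerosInGaps false α
    ≡⟨ +-comm-middle (countWords n (movesOneᵇ false α)) _ _ ⟩
  countWords n (movesOneᵇ false α) + zerosInGaps false α + countWords n (dropsOneᵇ false α)
    ≡⟨ cong₂ _+_ (countWords-movesOne-odd α) (countWords-dropsOne false α) ⟩
  ⌊ ones α /2⌋ * zerosInGaps true α + ⌈ ones α /2⌉ * zerosInGaps false α + ⌊ ones α /2⌋
    ≡⟨ zero-in-even-gap ⌊ ones α /2⌋ ⌈ ones α /2⌉ (zerosInGaps true α) (zerosInGaps false α) ⟩
  ⌊ ones α /2⌋ * suc (zerosInGaps true α) + ⌈ ones α /2⌉ * zerosInGaps false α ∎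
  where
  open ≡-Reasoning
  +-comm-middle : ∀ x y z → x + y + z ≡ x + z + y
  +-comm-middle = solve-∀
  zero-in-even-gap : ∀ f c e o → f * e + c * o + f ≡ f * suc e + c * o
  zero-in-even-gap = solve-∀
countWords-movesOne-odd {suc n} (true ∷ᵛ α) = begin
  countWords (suc n) (movesOneᵇ false (true ∷ᵛ α)) + zerosInGaps false (true ∷ᵛ α)
    ≡⟨ cong (_+ zerosInGaps false (true ∷ᵛ α)) (countWords-suc n _) ⟩
  countWords n (addsOneᵇ false α) + countWords n (movesOneᵇ false α) + zerosInGaps true α
    ≡⟨ cong (_+ zerosInGaps true α) (cong₂ _+_ (countWords-addsOne false α) refl) ⟩
  zerosInGaps false α + countWords n (movesOneᵇ false α) + zerosInGaps true α
    ≡⟨ cong (_+ zerosInGaps true α) (+-comm (zerosInGaps false α) _) ⟩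
  countWords n (movesOneᵇ false α) + zerosInGaps false α + zerosInGaps true α
    ≡⟨ cong (_+ zerosInGaps true α) (countWords-movesOne-odd α) ⟩
  ⌊ ones α /2⌋ * zerosInGaps true α + ⌈ ones α /2⌉ * zerosInGaps false α + zerosInGaps true α
    ≡⟨ one-swaps-gaps ⌊ ones α /2⌋ ⌈ ones α /2⌉ (zerosInGaps true α) (zerosInGaps false α) ⟩
  ⌈ ones α /2⌉ * zerosInGaps false α + suc ⌊ ones α /2⌋ * zerosInGaps true α ∎
  where
  open ≡-Reasoning
  one-swaps-gaps : ∀ f c e o → f * e + c * o + e ≡ c * o + suc f * e
  one-swaps-gaps = solve-∀

-- Closed forms of the signed degrees

ones+zeros≡length : ∀ {n} (α : Word n) → ones α + (zerosInGaps true α + zerosInGaps false α) ≡ n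
ones+zeros≡length []ᵛ = refl
ones+zeros≡length (false ∷ᵛ α) = trans (+-suc (ones α) _) (cong suc (ones+zeros≡length α))
ones+zeros≡length (true ∷ᵛ α) =
  cong suc (trans (cong (ones α +_) (+-comm (zerosInGaps false α) _)) (ones+zeros≡length α))

length∸ones≡zeros : ∀ {n} (α : Word n) → n ∸ ones α ≡ zerosInGaps true α + zerosInGaps false α
length∸ones≡zeros {n} α = trans (cong (_∸ ones α) (sym (ones+zeros≡length α))) (m+n∸m≡n (ones α) _)

n%2≡0⊎n%2≡1 : ∀ n → n % 2 ≡ 0 ⊎ n % 2 ≡ 1
n%2≡0⊎n%2≡1 zero = inj₁ refl
n%2≡0⊎n%2≡1 (suc zero) = inj₂ refl
n%2≡0⊎n%2≡1 (suc (suc n)) = n%2≡0⊎n%2≡1 n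

⌈n/2⌉≡⌊n/2⌋ : ∀ n → n % 2 ≡ 0 → ⌈ n /2⌉ ≡ ⌊ n /2⌋
⌈n/2⌉≡⌊n/2⌋ zero _ = refl
⌈n/2⌉≡⌊n/2⌋ (suc (suc n)) even = cong suc (⌈n/2⌉≡⌊n/2⌋ n even)

⌈n/2⌉≡1+⌊n/2⌋ : ∀ n → n % 2 ≡ 1 → ⌈ n /2⌉ ≡ suc ⌊ n /2⌋
⌈n/2⌉≡1+⌊n/2⌋ (suc zero) _ = refl
⌈n/2⌉≡1+⌊n/2⌋ (suc (suc n)) odd = cong suc (⌈n/2⌉≡1+⌊n/2⌋ n odd)

⌊n∸1/2⌋≡⌊n/2⌋ : ∀ n → n % 2 ≡ 1 → ⌊ n ∸ 1 /2⌋ ≡ ⌊ n /2⌋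
⌊n∸1/2⌋≡⌊n/2⌋ (suc zero) _ = refl
⌊n∸1/2⌋≡⌊n/2⌋ (suc (suc n)) odd = ⌈n/2⌉≡1+⌊n/2⌋ n odd

kplus-gaps : ∀ {n} (α : Word n) →
  kplus n (ones α) α ≡ ⌈ ones α /2⌉ * zerosInGaps true α + suc ⌊ ones α /2⌋ * zerosInGaps false α
kplus-gaps α = trans (signedDegree≡movesOne true α) (countWords-movesOne-even α)

kminus-gaps : ∀ {n} (α : Word n) →
  kminus n (ones α) α + zerosInGaps false α
    ≡ ⌊ ones α /2⌋ * zerosInGaps true α + ⌈ ones α /2⌉ * zerosInGaps false α
kminus-gaps α = trans (cong (_+ zerosInGaps false α) (signedDegree≡movesOne false α)) (countWords-movesOne-odd α)

module _ {n d : ℕ} (α : Word n) where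

  private
    e o : ℕ
    e = zerosInGaps true α
    o = zerosInGaps false α

    m*e+[1+m]*o≡m*[e+o]+o : ∀ m e o → m * e + suc m * o ≡ m * (e + o) + o
    m*e+[1+m]*o≡m*[e+o]+o = solve-∀

  kplus-odd : InB n d α → d % 2 ≡ 1 → kplus n d α ≡ ⌊ d + 1 /2⌋ * (n ∸ d)
  kplus-odd refl odd = begin
    kplus n d α                              ≡⟨ kplus-gaps α ⟩
    ⌈ d /2⌉ * e + suc ⌊ d /2⌋ * o            ≡⟨ cong (λ c → c * e + suc ⌊ d /2⌋ * o) (⌈n/2⌉≡1+⌊n/2⌋ d odd) ⟩
    suc ⌊ d /2⌋ * e + suc ⌊ d /2⌋ * o        ≡⟨ *-distribˡ-+ (suc ⌊ d /2⌋) e o ⟨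
    suc ⌊ d /2⌋ * (e + o)                    ≡⟨ cong₂ _*_ ⌊d+1/2⌋≡1+⌊d/2⌋ (length∸ones≡zeros α) ⟨
    ⌊ d + 1 /2⌋ * (n ∸ d)                    ∎
    where
    open ≡-Reasoning
    ⌊d+1/2⌋≡1+⌊d/2⌋ : ⌊ d + 1 /2⌋ ≡ suc ⌊ d /2⌋
    ⌊d+1/2⌋≡1+⌊d/2⌋ = trans (cong ⌊_/2⌋ (+-comm d 1)) (⌈n/2⌉≡1+⌊n/2⌋ d odd)

  kminus-odd : InB n d α → d % 2 ≡ 1 → kminus n d α ≡ ⌊ d ∸ 1 /2⌋ * (n ∸ d)
  kminus-odd refl odd = +-cancelʳ-≡ o _ _ (begin
    kminus n d α + o                         ≡⟨ kminus-gaps α ⟩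
    ⌊ d /2⌋ * e + ⌈ d /2⌉ * o                ≡⟨ cong (λ c → ⌊ d /2⌋ * e + c * o) (⌈n/2⌉≡1+⌊n/2⌋ d odd) ⟩
    ⌊ d /2⌋ * e + suc ⌊ d /2⌋ * o            ≡⟨ m*e+[1+m]*o≡m*[e+o]+o ⌊ d /2⌋ e o ⟩
    ⌊ d /2⌋ * (e + o) + o                    ≡⟨ cong₂ (λ f z → f * z + o) (⌊n∸1/2⌋≡⌊n/2⌋ d odd) (length∸ones≡zeros α) ⟨
    ⌊ d ∸ 1 /2⌋ * (n ∸ d) + o                ∎)
    where open ≡-Reasoning

  kplus-even : InB n d α → d % 2 ≡ 0 → kplus n d α ≡ ⌊ d /2⌋ * (n ∸ d) + o
  kplus-even refl even = begin
    kplus n d α                              ≡⟨ kplus-gaps α ⟩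
    ⌈ d /2⌉ * e + suc ⌊ d /2⌋ * o            ≡⟨ cong (λ c → c * e + suc ⌊ d /2⌋ * o) (⌈n/2⌉≡⌊n/2⌋ d even) ⟩
    ⌊ d /2⌋ * e + suc ⌊ d /2⌋ * o            ≡⟨ m*e+[1+m]*o≡m*[e+o]+o ⌊ d /2⌋ e o ⟩
    ⌊ d /2⌋ * (e + o) + o                    ≡⟨ cong (λ z → ⌊ d /2⌋ * z + o) (length∸ones≡zeros α) ⟨
    ⌊ d /2⌋ * (n ∸ d) + o                    ∎
    where open ≡-Reasoning

  kminus-even : InB n d α → d % 2 ≡ 0 → kminus n d α + o ≡ ⌊ d /2⌋ * (n ∸ d)
  kminus-even refl even = begin
    kminus n d α + o                         ≡⟨ kminus-gaps α ⟩
    ⌊ d /2⌋ * e + ⌈ d /2⌉ * o                ≡⟨ cong (λ c → ⌊ d /2⌋ * e + c * o) (⌈n/2⌉≡⌊n/2⌋ d even) ⟩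
    ⌊ d /2⌋ * e + ⌊ d /2⌋ * o                ≡⟨ *-distribˡ-+ ⌊ d /2⌋ e o ⟨
    ⌊ d /2⌋ * (e + o)                        ≡⟨ cong (⌊ d /2⌋ *_) (length∸ones≡zeros α) ⟨
    ⌊ d /2⌋ * (n ∸ d)                        ∎
    where open ≡-Reasoning

sumAlternate : Bool → List ℕ → ℕ
sumAlternate t [] = 0
sumAlternate true (x ∷ xs) = x + sumAlternate false xs
sumAlternate false (x ∷ xs) = sumAlternate true xs

sumAlternate-applyUpTo : ∀ xs (f : ℕ → ℕ) → (∀ ℓ → f ℓ ≡ nth xs (2 * ℓ + 1)) →
  sum (applyUpTo f ⌊ length xs /2⌋) ≡ sumAlternate false xs
sumAlternate-applyUpTo [] f _ = refl
sumAlternate-applyUpTo (_ ∷ []) f _ = refl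
sumAlternate-applyUpTo (x ∷ y ∷ xs) f f≗ = cong₂ _+_ (f≗ 0) (sumAlternate-applyUpTo xs (f ∘ suc) shifted)
  where
  shifted : ∀ ℓ → f (suc ℓ) ≡ nth xs (2 * ℓ + 1)
  shifted ℓ = trans (f≗ (suc ℓ)) (cong (λ i → nth (x ∷ y ∷ xs) (i + 1)) (*-suc 2 ℓ))

sumAlternate-gaps : ∀ {n} t (α : Word n) → sumAlternate t (gaps α) ≡ zerosInGaps t α
sumAlternate-gaps true []ᵛ = refl
sumAlternate-gaps false []ᵛ = refl
sumAlternate-gaps true (true ∷ᵛ α) = sumAlternate-gaps false α
sumAlternate-gaps false (true ∷ᵛ α) = sumAlternate-gaps true α
sumAlternate-gaps true (false ∷ᵛ α) with gaps α | sumAlternate-gaps true α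
... | [] | ih = cong suc ih
... | _ ∷ _ | ih = cong suc ih
sumAlternate-gaps false (false ∷ᵛ α) with gaps α | sumAlternate-gaps false α
... | [] | ih = ih
... | _ ∷ _ | ih = ih

length-gaps : ∀ {n} (α : Word n) → length (gaps α) ≡ suc (ones α)
length-gaps []ᵛ = refl
length-gaps (true ∷ᵛ α) = cong suc (length-gaps α)
length-gaps (false ∷ᵛ α) with gaps α | length-gaps α
... | _ ∷ _ | ih = ih

r≡zerosInOddGaps : ∀ {n d} (α : Word n) → 1 ≤ d → InB n d α → r d α ≡ zerosInGaps false α
r≡zerosInOddGaps {d = suc d} α _ α∈ = begin
  sum (map oddGap (upTo (suc ⌊ d /2⌋)))
    ≡⟨ cong sum (map-upTo oddGap (suc ⌊ d /2⌋)) ⟩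
  sum (applyUpTo oddGap ⌈ suc d /2⌉)
    ≡⟨ cong (λ m → sum (applyUpTo oddGap ⌊ m /2⌋)) (trans (cong suc (sym α∈)) (sym (length-gaps α))) ⟩
  sum (applyUpTo oddGap ⌊ length (gaps α) /2⌋)
    ≡⟨ sumAlternate-applyUpTo (gaps α) oddGap (λ _ → refl) ⟩
  sumAlternate false (gaps α)
    ≡⟨ sumAlternate-gaps false α ⟩
  zerosInGaps false α ∎
  where
  open ≡-Reasoning
  oddGap : ℕ → ℕ
  oddGap ℓ = z (2 * ℓ + 1) α

-- Regularity

onesThenZeros : (n d : ℕ) → Word n
onesThenZeros zero _ = []ᵛ
onesThenZeros (suc n) zero = false ∷ᵛ onesThenZeros n zero
onesThenZeros (suc n) (suc d) = true ∷ᵛ onesThenZeros n d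

ones-onesThenZeros : ∀ {n d} → d ≤ n → ones (onesThenZeros n d) ≡ d
ones-onesThenZeros {zero} z≤n = refl
ones-onesThenZeros {suc n} z≤n = ones-onesThenZeros {n} z≤n
ones-onesThenZeros (s≤s d≤n) = cong suc (ones-onesThenZeros d≤n)

zerosInOddGaps-onesThenZeros : ∀ n d → d % 2 ≡ 0 → zerosInGaps false (onesThenZeros n d) ≡ 0
zerosInOddGaps-onesThenZeros zero d _ = refl
zerosInOddGaps-onesThenZeros (suc n) zero _ = zerosInOddGaps-onesThenZeros n zero refl
zerosInOddGaps-onesThenZeros (suc zero) (suc (suc d)) _ = refl
zerosInOddGaps-onesThenZeros (suc (suc n)) (suc (suc d)) even = zerosInOddGaps-onesThenZeros n d even

zerosInOddGaps-nonconstant : ∀ {n d} → 1 ≤ d → d < n → d % 2 ≡ 0 →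
  ∃[ α ] ∃[ β ] InB n d α × InB n d β × zerosInGaps false α ≢ zerosInGaps false β
zerosInOddGaps-nonconstant {suc (suc n)} {suc d} _ (s≤s (s≤s d≤n)) even =
  onesThenZeros (suc (suc n)) (suc d) , true ∷ᵛ false ∷ᵛ onesThenZeros n d ,
  ones-onesThenZeros (s≤s (m≤n⇒m≤1+n d≤n)) , cong suc (ones-onesThenZeros d≤n) ,
  λ o≡ → 0≢1+n (trans (sym (zerosInOddGaps-onesThenZeros (suc (suc n)) (suc d) even)) o≡)

IsConstantOn : (n d : ℕ) → (Word n → ℕ) → Set
IsConstantOn n d k = ∀ α β → InB n d α → InB n d β → k α ≡ k β

constant⇔odd : ∀ {n d} (k : Word n → ℕ) → 1 ≤ d → d < n →
  (d % 2 ≡ 1 → IsConstantOn n d k) →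
  (d % 2 ≡ 0 → ∀ α β → InB n d α → InB n d β → k α ≡ k β → zerosInGaps false α ≡ zerosInGaps false β) →
  IsConstantOn n d k ⇔ d % 2 ≡ 1
constant⇔odd {d = d} k 1≤d d<n constantIfOdd separatesIfEven = mk⇔ onlyIfOdd constantIfOdd
  where
  onlyIfOdd : IsConstantOn _ d k → d % 2 ≡ 1
  onlyIfOdd constant with n%2≡0⊎n%2≡1 d
  ... | inj₂ odd = odd
  ... | inj₁ even with α , β , α∈ , β∈ , o≢ ← zerosInOddGaps-nonconstant 1≤d d<n even =
    contradiction (separatesIfEven even α β α∈ β∈ (constant α β α∈ β∈)) o≢

regularPlus⇔odd : ∀ {n d} → 1 ≤ d → d < n → RegularPlus n d ⇔ d % 2 ≡ 1
regularPlus⇔odd {n} {d} 1≤d d<n = constant⇔odd (kplus n d) 1≤d d<n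
  (λ odd α β α∈ β∈ → trans (kplus-odd α α∈ odd) (sym (kplus-odd β β∈ odd)))
  (λ even α β α∈ β∈ k≡ → +-cancelˡ-≡ _ _ _ (trans (sym (kplus-even α α∈ even)) (trans k≡ (kplus-even β β∈ even))))

regularMinus⇔odd : ∀ {n d} → 1 ≤ d → d < n → RegularMinus n d ⇔ d % 2 ≡ 1
regularMinus⇔odd {n} {d} 1≤d d<n = constant⇔odd (kminus n d) 1≤d d<n
  (λ odd α β α∈ β∈ → trans (kminus-odd α α∈ odd) (sym (kminus-odd β β∈ odd)))
  (λ even α β α∈ β∈ k≡ → +-cancelˡ-≡ (kminus n d α) _ _
    (trans (trans (kminus-even α α∈ even) (sym (kminus-even β β∈ even))) (cong (_+ _) (sym k≡))))

theorem5p3 : (n d : ℕ) → 1 ≤ d → d + 1 ≤ n →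
  ((α : Word n) → InB n d α →
    (d % 2 ≡ 1 →
      kplus n d α ≡ ⌊ d + 1 /2⌋ * (n ∸ d) × kminus n d α ≡ ⌊ d ∸ 1 /2⌋ * (n ∸ d))
    × (d % 2 ≡ 0 →
      kplus n d α ≡ ⌊ d /2⌋ * (n ∸ d) + r d α × kminus n d α + r d α ≡ ⌊ d /2⌋ * (n ∸ d)))
  × (RegularPlus n d ⇔ d % 2 ≡ 1)
  × (RegularMinus n d ⇔ d % 2 ≡ 1)
theorem5p3 n d 1≤d d+1≤n =
    (λ α α∈ →
        (λ odd → kplus-odd α α∈ odd , kminus-odd α α∈ odd)
      , (λ even → trans (kplus-even α α∈ even) (cong (⌊ d /2⌋ * (n ∸ d) +_) (sym (r≡zerosInOddGaps α 1≤d α∈)))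
                , trans (cong (kminus n d α +_) (r≡zerosInOddGaps α 1≤d α∈)) (kminus-even α α∈ even)))
  , regularPlus⇔odd 1≤d d<n
  , regularMinus⇔odd 1≤d d<n
  where
  d<n : d < n
  d<n = subst (_≤ n) (+-comm d 1) d+1≤n
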